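{- For any job processing times $\mathbf{p}$ and number $m$ of bags, let $\mathcal{B}_{\textsc{LPT}}=\{B_1,\dots,B_m\}$ be the partition of the $n$ jobs into $m$ bags produced by the LPT algorithm, indexed so that $p(B_1)\ge\cdots\ge p(B_m)$. If $|B_1|>1$, then $p(B_1)\le\frac{2\sum_{B\in\mathcal{B}_{\textsc{LPT}}}p(B)}{m+1}$.
   Context: $p(B)=\sum_{j\in B}p_j$ with $p_j\ge0$. The LPT algorithm starts with $m$ empty bags, considers the jobs in nonincreasing order of processing time, and adds each job to a bag of currently minimum total processing time.
   Formalization: The job processing times $p_j$ are rational numbers, so the bag loads $p(B)$ are rational as well. -}

module Defs where

open import Data.Nat using (ℕ)
open import Data.Fin using (Fin)
open import Data.List using (List; []; _∷_)
import Data.List as L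
open import Data.Vec using (Vec; lookup; replicate; _[_]%=_)
import Data.Vec as V
open import Data.Rational using (ℚ; 0ℚ; _+_; _≤_; _≥_)
open import Data.List.Relation.Unary.Linked using (Linked)
open import Data.List.Relation.Binary.Permutation.Propositional using (_↭_)
open import Data.Product using (Σ; _×_)

-- a bag is the list of processing times of the jobs it contains
-- p(B) = sum of processing times in B
p : List ℚ → ℚ
p = L.foldr _+_ 0ℚ

total : ∀ {m} → Vec (List ℚ) m → ℚ
total = V.foldr _ (λ B acc → p B + acc) 0ℚ

data LPTFrom {m : ℕ} : List ℚ → Vec (List ℚ) m → Vec (List ℚ) m → Set where
  done : ∀ bs → LPTFrom [] bs bs
  step : ∀ j js bs fin (i : Fin m) →
         (∀ k → p (lookup bs i) ≤ p (lookup bs k)) →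
         LPTFrom js (bs [ i ]%= (j ∷_)) fin →
         LPTFrom (j ∷ js) bs fin

LPT : (m : ℕ) → List ℚ → Vec (List ℚ) m → Set
LPT m jobs bags =
  Σ (List ℚ) λ order →
    (order ↭ jobs) × Linked _≥_ order × LPTFrom order (replicate m []) bags

{-# OPTIONS --safe #-}
-- Throughout the run of LPT every bag B with at least two jobs satisfies
-- (m+1)·p(B) ≤ 2·Σ p. When a job j joins a least loaded bag B that is already
-- nonempty, every job in B is at least j (jobs arrive in nonincreasing order), so
-- j ≤ p(B) ≤ Σ p / m, and (m+1)(j + p(B)) ≤ 2j + 2m·p(B) ≤ 2(j + Σ p); every other
-- bag keeps its load while the total grows.
module Submission where

open import Defs
open import Data.Nat using (ℕ; suc; zero)
import Data.Nat as N
import Data.Nat.Properties as ℕₚ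
open import Data.Fin using (Fin; zero; suc)
open import Data.Fin.Properties using (_≟_)
open import Data.List using (List; []; _∷_; length)
open import Data.List.Relation.Unary.All as All using (All; []; _∷_)
open import Data.List.Relation.Unary.Linked as Linked using (Linked; _∷_)
open import Data.List.Relation.Binary.Permutation.Propositional using (↭-sym)
open import Data.List.Relation.Binary.Permutation.Propositional.Properties using (All-resp-↭)
open import Data.Vec using (Vec; lookup; replicate; _[_]%=_; []; _∷_)
open import Data.Vec.Properties using (lookup∘updateAt; lookup∘updateAt′; lookup-replicate)
import Data.Integer as ℤ
open ℤ using (+_)
import Data.Integer.Properties as ℤₚ
open import Data.Rational
  using (ℚ; 0ℚ; 1ℚ; _≤_; _≥_; _*_; _+_; _/_; toℚᵘ; Positive; positive; +-0-rawMonoid)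
open import Data.Rational.Properties hiding (_≟_)
import Data.Rational.Unnormalised as ℚᵘ
import Data.Rational.Unnormalised.Properties as ℚᵘ
open import Data.Rational.Solver using (module +-*-Solver)
open import Algebra.Bundles using (CommutativeMonoid; Ring)
open import Algebra.Definitions.RawMonoid +-0-rawMonoid using (_×_)
open import Algebra.Properties.CommutativeMonoid.Mult +-0-commutativeMonoid using (×-distrib-+)
open import Algebra.Properties.CommutativeSemigroup (CommutativeMonoid.commutativeSemigroup +-0-commutativeMonoid) using (x∙yz≈y∙xz)
open import Algebra.Properties.Semiring.Mult (Ring.semiring +-*-ring) using (×-assoc-*)
open import Data.Product using (_,_)
open import Data.Unit using (⊤; tt)
open import Relation.Nullary using (yes; no)
open import Relation.Binary.PropositionalEquality

×-monoʳ-≤ : ∀ n {x y} → x ≤ y → n × x ≤ n × y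
×-monoʳ-≤ zero    x≤y = ≤-refl
×-monoʳ-≤ (suc n) x≤y = +-mono-≤ x≤y (×-monoʳ-≤ n x≤y)

×≡×1* : ∀ n x → n × x ≡ (n × 1ℚ) * x
×≡×1* n x = sym (trans (×-assoc-* n 1ℚ x) (cong (n ×_) (*-identityˡ x)))

toℚᵘ-×1 : ∀ n → toℚᵘ (n × 1ℚ) ℚᵘ.≃ ℚᵘ.mkℚᵘ (+ n) 0
toℚᵘ-×1 zero    = ℚᵘ.≃-refl
toℚᵘ-×1 (suc n) = begin-equality
  toℚᵘ (1ℚ + n × 1ℚ)                        ≃⟨ toℚᵘ-homo-+ 1ℚ (n × 1ℚ) ⟩
  ℚᵘ.1ℚᵘ ℚᵘ.+ toℚᵘ (n × 1ℚ)                  ≃⟨ ℚᵘ.+-congʳ ℚᵘ.1ℚᵘ (toℚᵘ-×1 n) ⟩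
  ℚᵘ.1ℚᵘ ℚᵘ.+ ℚᵘ.mkℚᵘ (+ n) 0               ≃⟨ ℚᵘ.*≡* (cong (λ k → (+ 1 ℤ.+ k) ℤ.* + 1) (ℤₚ.*-identityʳ (+ n))) ⟩
  ℚᵘ.mkℚᵘ (+ suc n) 0                       ∎
  where open ℚᵘ.≤-Reasoning

suc*2≡2*suc : ∀ m → (+ suc m ℤ.* + 2) ℤ.* + 1 ≡ + 2 ℤ.* + (1 N.* suc m)
suc*2≡2*suc m = begin
  (+ suc m ℤ.* + 2) ℤ.* + 1   ≡⟨ ℤₚ.*-identityʳ _ ⟩
  + suc m ℤ.* + 2             ≡⟨ ℤₚ.*-comm (+ suc m) (+ 2) ⟩
  + 2 ℤ.* + suc m             ≡⟨ cong (λ k → + 2 ℤ.* + k) (ℕₚ.*-identityˡ (suc m)) ⟨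
  + 2 ℤ.* + (1 N.* suc m)     ∎
  where open ≡-Reasoning

suc×1*2/suc≡2 : ∀ m → (suc m × 1ℚ) * (+ 2 / suc m) ≡ 2 × 1ℚ
suc×1*2/suc≡2 m = toℚᵘ-injective (begin-equality
  toℚᵘ ((suc m × 1ℚ) * (+ 2 / suc m))        ≃⟨ toℚᵘ-homo-* (suc m × 1ℚ) (+ 2 / suc m) ⟩
  toℚᵘ (suc m × 1ℚ) ℚᵘ.* toℚᵘ (+ 2 / suc m) ≃⟨ ℚᵘ.*-cong (toℚᵘ-×1 (suc m)) (toℚᵘ-fromℚᵘ (ℚᵘ.mkℚᵘ (+ 2) m)) ⟩
  ℚᵘ.mkℚᵘ (+ suc m) 0 ℚᵘ.* ℚᵘ.mkℚᵘ (+ 2) m  ≃⟨ ℚᵘ.*≡* (suc*2≡2*suc m) ⟩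
  toℚᵘ (2 × 1ℚ)                              ∎)
  where open ℚᵘ.≤-Reasoning

×-nonNeg : ∀ n {x} → 0ℚ ≤ x → 0ℚ ≤ n × x
×-nonNeg zero    0≤x = ≤-refl
×-nonNeg (suc n) 0≤x = +-mono-≤ 0≤x (×-nonNeg n 0≤x)

suc×≤2×⇒≤2/suc* : ∀ m {x y} → suc m × x ≤ 2 × y → x ≤ (+ 2 / suc m) * y
suc×≤2×⇒≤2/suc* m {x} {y} h = *-cancelˡ-≤-pos c (begin
  c * x                      ≡⟨ ×≡×1* (suc m) x ⟨
  suc m × x                  ≤⟨ h ⟩
  2 × y                      ≡⟨ ×≡×1* 2 y ⟩
  (2 × 1ℚ) * y               ≡⟨ cong (_* y) (suc×1*2/suc≡2 m) ⟨
  (c * (+ 2 / suc m)) * y    ≡⟨ *-assoc c (+ 2 / suc m) y ⟩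
  c * ((+ 2 / suc m) * y)    ∎)
  where
  c = suc m × 1ℚ
  instance
    c-pos : Positive c
    c-pos = positive (+-mono-<-≤ (positive⁻¹ 1ℚ) (×-nonNeg m (≤ᵇ⇒≤ _)))
  open ≤-Reasoning

lpt-step-bound : ∀ m {j L T} → j ≤ L → suc m × L ≤ T → suc (suc m) × (j + L) ≤ 2 × (j + T)
lpt-step-bound m {j} {L} {T} j≤L sucm×L≤T = begin
  (j + L) + ((j + L) + m × (j + L))       ≡⟨ cong (λ z → (j + L) + ((j + L) + z)) (×-distrib-+ j L m) ⟩
  (j + L) + ((j + L) + (m × j + m × L))   ≤⟨ +-monoʳ-≤ (j + L) (+-monoʳ-≤ (j + L) (+-monoˡ-≤ (m × L) (×-monoʳ-≤ m j≤L))) ⟩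
  (j + L) + ((j + L) + (m × L + m × L))   ≡⟨ regroup j L (m × L) ⟩
  2 × (j + suc m × L)                     ≤⟨ ×-monoʳ-≤ 2 (+-monoʳ-≤ j sucm×L≤T) ⟩
  2 × (j + T)                             ∎
  where
  open ≤-Reasoning
  open +-*-Solver
  regroup : ∀ j L A → (j + L) + ((j + L) + (A + A)) ≡ 2 × (j + (L + A))
  regroup = solve 3 (λ j L A → (j :+ L) :+ ((j :+ L) :+ (A :+ A))
                             := (j :+ (L :+ A)) :+ ((j :+ (L :+ A)) :+ con 0ℚ)) refl

p-nonNeg : ∀ {B} → All (0ℚ ≤_) B → 0ℚ ≤ p B
p-nonNeg []          = ≤-refl
p-nonNeg (0≤x ∷ 0≤B) = +-mono-≤ 0≤x (p-nonNeg 0≤B)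

≤p-nonEmpty : ∀ {j B} → 0ℚ ≤ j → All (j ≤_) B → 0 N.< length B → j ≤ p B
≤p-nonEmpty {j} {x ∷ B} 0≤j (j≤x ∷ j≤B) _ = begin
  j        ≡⟨ +-identityʳ j ⟨
  j + 0ℚ   ≤⟨ +-mono-≤ j≤x (p-nonNeg (All.map (≤-trans 0≤j) j≤B)) ⟩
  p (x ∷ B) ∎
  where open ≤-Reasoning

total-updateAt-∷ : ∀ {n} (bs : Vec (List ℚ) n) i j → total (bs [ i ]%= (j ∷_)) ≡ j + total bs
total-updateAt-∷ (b ∷ bs) zero    j = +-assoc j (p b) (total bs)
total-updateAt-∷ (b ∷ bs) (suc i) j =
  trans (cong (λ t → p b + t) (total-updateAt-∷ bs i j)) (x∙yz≈y∙xz (p b) j (total bs))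

×≤total : ∀ {n} (bs : Vec (List ℚ) n) {L} → (∀ k → L ≤ p (lookup bs k)) → n × L ≤ total bs
×≤total []       L≤ = ≤-refl
×≤total (b ∷ bs) L≤ = +-mono-≤ (L≤ zero) (×≤total bs (λ k → L≤ (suc k)))

module _ {m : ℕ} where

  Balanced : Vec (List ℚ) m → Set
  Balanced bs = ∀ k → 1 N.< length (lookup bs k) → suc m × p (lookup bs k) ≤ 2 × total bs

  JobsAtLeast : ℚ → Vec (List ℚ) m → Set
  JobsAtLeast j bs = ∀ k → All (j ≤_) (lookup bs k)

  -- Tracking only the next job suffices: the remaining jobs are sorted.
  NextJobAtMost : List ℚ → Vec (List ℚ) m → Set
  NextJobAtMost []      bs = ⊤
  NextJobAtMost (j ∷ _) bs = JobsAtLeast j bs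

updateAt-balanced : ∀ {m} (bs : Vec (List ℚ) m) i {j} → 0ℚ ≤ j →
  (∀ k → p (lookup bs i) ≤ p (lookup bs k)) → JobsAtLeast j bs →
  Balanced bs → Balanced (bs [ i ]%= (j ∷_))
updateAt-balanced {suc m} bs i {j} 0≤j i-min j≤bs bal k 1<|B| with k ≟ i
... | yes refl rewrite lookup∘updateAt k {j ∷_} bs | total-updateAt-∷ bs k j =
  lpt-step-bound m (≤p-nonEmpty 0≤j (j≤bs k) (N.≤-pred 1<|B|)) (×≤total bs i-min)
... | no k≢i rewrite lookup∘updateAt′ k i {j ∷_} k≢i bs | total-updateAt-∷ bs i j =
  ≤-trans (bal k 1<|B|) (×-monoʳ-≤ 2 T≤j+T)
  where
  T≤j+T : total bs ≤ j + total bs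
  T≤j+T = ≤-trans (≤-reflexive (sym (+-identityˡ (total bs)))) (+-monoˡ-≤ (total bs) 0≤j)

updateAt-nextJobAtMost : ∀ {m} (bs : Vec (List ℚ) m) i j js → Linked _≥_ (j ∷ js) →
  JobsAtLeast j bs → NextJobAtMost js (bs [ i ]%= (j ∷_))
updateAt-nextJobAtMost bs i j []        _            _    = tt
updateAt-nextJobAtMost bs i j (j′ ∷ js) (j′≤j ∷ _) j≤bs k with k ≟ i
... | yes refl rewrite lookup∘updateAt k {j ∷_} bs = j′≤j ∷ All.map (≤-trans j′≤j) (j≤bs k)
... | no k≢i rewrite lookup∘updateAt′ k i {j ∷_} k≢i bs = All.map (≤-trans j′≤j) (j≤bs k)

LPTFrom-balanced : ∀ {m js} {bs fin : Vec (List ℚ) m} → LPTFrom js bs fin →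
  All (0ℚ ≤_) js → Linked _≥_ js → NextJobAtMost js bs → Balanced bs → Balanced fin
LPTFrom-balanced (done _) _ _ _ bal = bal
LPTFrom-balanced (step j js bs _ i i-min run) (0≤j ∷ 0≤js) sorted j≤bs bal =
  LPTFrom-balanced run 0≤js (Linked.tail sorted)
    (updateAt-nextJobAtMost bs i j js sorted j≤bs)
    (updateAt-balanced bs i 0≤j i-min j≤bs bal)

replicate-balanced : ∀ m → Balanced (replicate m [])
replicate-balanced m k 1<|B| with () ← subst (λ B → 1 N.< length B) (lookup-replicate k []) 1<|B|

replicate-nextJobAtMost : ∀ m js → NextJobAtMost js (replicate m [])
replicate-nextJobAtMost m []      = tt
replicate-nextJobAtMost m (j ∷ _) k = subst (All (j ≤_)) (sym (lookup-replicate k [])) []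

-- The bound holds for every bag with at least two jobs.
lemma17 : (m : ℕ) (jobs : List ℚ) → All (0ℚ ≤_) jobs →
    (bags : Vec (List ℚ) m) → LPT m jobs bags →
    (i : Fin m) → (∀ k → p (lookup bags k) ≤ p (lookup bags i)) →
    1 N.< length (lookup bags i) →
    p (lookup bags i) ≤ (+ 2 / suc m) * total bags
lemma17 m jobs 0≤jobs bags (order , order↭jobs , sorted , run) i _ 1<|Bᵢ| =
  suc×≤2×⇒≤2/suc* m (balanced i 1<|Bᵢ|)
  where
  balanced : Balanced bags
  balanced = LPTFrom-balanced run (All-resp-↭ (↭-sym order↭jobs) 0≤jobs) sorted
    (replicate-nextJobAtMost m order) (replicate-balanced m)
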